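{- Let $G$ be a chordal graph, let $C$ be a clique of $G$ such that $G\setminus C$ is nonempty, and let $A$ be a largest connected component of $G\setminus C$. Then at least one of the following holds: (i) there exists a vertex $v\in C$ that is adjacent to no vertex of $A$; (ii) there exists a vertex $u\in A$ that is adjacent to every vertex of $C$.
   Context: A graph is chordal if every cycle of length at least four has a chord, i.e., an edge joining two vertices that are not consecutive on the cycle. $G\setminus C$ denotes the subgraph induced on $V(G)\setminus C$. -}

module Defs where

open import Data.Nat using (ℕ; zero; suc; _≤_)
open import Data.Fin using (Fin; zero; suc; toℕ; inject₁; fromℕ)
open import Data.Fin.Subset using (Subset; _∈_; _∉_; ∣_∣)
open import Data.Bool using (Bool; true; false)
open import Data.Product using (Σ; _×_; ∃)
open import Data.Sum using (_⊎_)
open import Relation.Nullary using (¬_)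
open import Relation.Binary.PropositionalEquality using (_≡_; _≢_)
open import Function.Definitions using (Injective)

record Graph (n : ℕ) : Set where
  field
    adj   : Fin n → Fin n → Bool
    sym   : ∀ u v → adj u v ≡ adj v u
    irrefl : ∀ v → adj v v ≡ false

open Graph public

Adj : ∀ {n} → Graph n → Fin n → Fin n → Set
Adj G u v = adj G u v ≡ true

record Cycle {n : ℕ} (G : Graph n) (m : ℕ) : Set where
  field
    vtx      : Fin (suc m) → Fin n
    distinct : Injective _≡_ _≡_ vtx
    edges    : ∀ (i : Fin m) → Adj G (vtx (inject₁ i)) (vtx (suc i))
    closing  : Adj G (vtx (fromℕ m)) (vtx zero)

open Cycle public

Consecutive : (m : ℕ) → Fin (suc m) → Fin (suc m) → Set
Consecutive m i j =
  (toℕ j ≡ suc (toℕ i)) ⊎ (toℕ i ≡ suc (toℕ j))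
  ⊎ ((toℕ i ≡ m × toℕ j ≡ 0) ⊎ (toℕ j ≡ m × toℕ i ≡ 0))

HasChord : ∀ {n} {G : Graph n} {m : ℕ} → Cycle G m → Set
HasChord {G = G} {m} c =
  Σ (Fin (suc m)) λ i → Σ (Fin (suc m)) λ j →
    i ≢ j × ¬ Consecutive m i j × Adj G (vtx c i) (vtx c j)

-- chordal: every cycle of length at least four has a chord
-- (a cycle of length suc m has length ≥ 4 iff 3 ≤ m)
Chordal : ∀ {n} → Graph n → Set
Chordal G = ∀ (m : ℕ) → 3 ≤ m → (c : Cycle G m) → HasChord c

IsClique : ∀ {n} → Graph n → Subset n → Set
IsClique G C = ∀ u v → u ∈ C → v ∈ C → u ≢ v → Adj G u v

data Reach {n : ℕ} (G : Graph n) (S : Subset n) (u : Fin n) : Fin n → Set where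
  here : u ∈ S → Reach G S u u
  step : ∀ {w v} → Reach G S u w → Adj G w v → v ∈ S → Reach G S u v

-- A is (the vertex set of) a connected component of G ∖ C:
-- nonempty, disjoint from C, connected inside A, and closed under
-- adjacency within V(G) ∖ C (i.e. maximal).
IsComponentOfRemoval : ∀ {n} → Graph n → Subset n → Subset n → Set
IsComponentOfRemoval G C A =
  (∃ λ v → v ∈ A)
  × (∀ v → v ∈ A → v ∉ C)
  × (∀ u v → u ∈ A → v ∈ A → Reach G A u v)
  × (∀ u v → u ∈ A → v ∉ C → Adj G u v → v ∈ A)

-- Suppose every vertex of C has a neighbour in A; we add the vertices of C
-- one at a time, keeping a vertex u ∈ A adjacent to all of them so far.
-- For a new vertex c, walk inside A from u to a neighbour of c and stop at
-- the first vertex y adjacent to c. For an earlier b, the path b, u, …, y, c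
-- closed by the edge cb is a closed walk whose interior lies in A. In a
-- chordal graph such a walk always has an interior vertex adjacent to both
-- ends: shortcut chords and repeated vertices until the walk is a chordless
-- cycle, which must be a triangle. That vertex is adjacent to c, hence it
-- is y, so y is adjacent to b as well.
module Submission where

open import Defs
open import Data.Nat using (ℕ; zero; suc; _+_; _∸_; _≤_; _<_; z≤n; s≤s; _≤?_; _<?_)
open import Data.Nat.Properties
open import Data.Nat.Induction using (<-rec)
open import Algebra.Properties.CommutativeSemigroup +-commutativeSemigroup using (xy∙z≈xz∙y)
open import Data.Fin using (Fin; toℕ)
import Data.Fin as Fin
open import Data.Fin.Properties using (toℕ-injective; toℕ-inject₁; toℕ-fromℕ; toℕ<n; toℕ≤pred[n]; any?)
open import Data.Fin.Subset using (Subset; _∈_; _∉_; ∣_∣)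
open import Data.Fin.Subset.Properties using (_∈?_)
open import Data.Bool using (true)
import Data.Bool.Properties as Bool
open import Data.List using (List; []; _∷_; allFin)
open import Data.List.Relation.Unary.Any using (here; there)
import Data.List.Membership.Propositional as List
open import Data.List.Membership.Propositional.Properties using (∈-allFin)
open import Data.Product using (Σ; _×_; ∃; ∃₂; _,_; proj₁; proj₂)
open import Data.Sum using (_⊎_; inj₁; inj₂)
open import Data.Empty using (⊥-elim)
open import Function using (_∘_)
open import Relation.Nullary using (¬_; Dec; yes; no)
open import Relation.Nullary.Decidable using (_×-dec_; _⊎-dec_; ¬?)
open import Level using (0ℓ)
open import Relation.Unary using (Pred; Decidable)
open import Relation.Binary.Definitions using (tri<; tri≈; tri>)
open import Relation.Binary.PropositionalEquality using (_≡_; _≢_; refl; cong; subst; subst₂; trans)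
import Relation.Binary.PropositionalEquality as ≡

splice : ∀ {X : Set} → ℕ → (ℕ → X) → (ℕ → X) → ℕ → X
splice x f g i with i ≤? x
... | yes _ = f i
... | no _  = g i

splice-≤ : ∀ {X : Set} {x i} (f g : ℕ → X) → i ≤ x → splice x f g i ≡ f i
splice-≤ {x = x} {i} f g i≤x with i ≤? x
... | yes _   = refl
... | no i≰x  = ⊥-elim (i≰x i≤x)

splice-> : ∀ {X : Set} {x i} (f g : ℕ → X) → x < i → splice x f g i ≡ g i
splice-> {x = x} {i} f g x<i with i ≤? x
... | yes i≤x = ⊥-elim (<⇒≱ x<i i≤x)
... | no _    = refl

least : ∀ {p} {P : Pred ℕ p} → Decidable P → ∀ {k} → P k →
        ∃ λ i → i ≤ k × P i × (∀ {j} → j < i → ¬ P j)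
least {p} {P} P? {k} = <-rec Goal go k
  where
  Goal : ℕ → Set p
  Goal k = P k → ∃ λ i → i ≤ k × P i × (∀ {j} → j < i → ¬ P j)

  go : ∀ k → (∀ {j} → j < k → Goal j) → Goal k
  go k rec Pk with anyUpTo? P? k
  ... | no none = k , ≤-refl , Pk , λ j<k Pj → none (_ , j<k , Pj)
  ... | yes (j , j<k , Pj) with rec j<k Pj
  ...   | i , i≤j , Pi , minimal = i , ≤-trans i≤j (<⇒≤ j<k) , Pi , minimal

consecutive-sym : ∀ {m} {i j : Fin (suc m)} → Consecutive m i j → Consecutive m j i
consecutive-sym (inj₁ e)               = inj₂ (inj₁ e)
consecutive-sym (inj₂ (inj₁ e))        = inj₁ e
consecutive-sym (inj₂ (inj₂ (inj₁ e))) = inj₂ (inj₂ (inj₂ e))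
consecutive-sym (inj₂ (inj₂ (inj₂ e))) = inj₂ (inj₂ (inj₁ e))

module _ {n : ℕ} (G : Graph n) where

  adj? : ∀ u v → Dec (Adj G u v)
  adj? u v = adj G u v Bool.≟ true

  Adj-sym : ∀ {u v} → Adj G u v → Adj G v u
  Adj-sym {u} {v} = trans (sym G v u)

  IsWalk : ℕ → (ℕ → Fin n) → Set
  IsWalk m w = ∀ i → i < m → Adj G (w i) (w (suc i))

  Interior : ℕ → (ℕ → Fin n) → Fin n → Set
  Interior m w v = ∃ λ i → 0 < i × i < m × w i ≡ v

  record ClosedWalk (m : ℕ) (w : ℕ → Fin n) : Set where
    field
      long            : 2 ≤ m
      walk            : IsWalk m w
      closing         : Adj G (w m) (w 0)
      ends-distinct   : w 0 ≢ w m
      start∉interior  : ¬ Interior m w (w 0)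
      end∉interior    : ¬ Interior m w (w m)

  open ClosedWalk

  -- an edge between positions that are not consecutive on the closed walk
  Chord : ℕ → (ℕ → Fin n) → ℕ → ℕ → Set
  Chord m w x y = suc x < y × y ≤ m × (0 < x ⊎ y < m) × Adj G (w x) (w y)

  chord? : ∀ m w → Dec (∃₂ (Chord m w))
  chord? m w with anyUpTo? (λ y → anyUpTo? (λ x → chord-at? x y) y) (suc m)
    where
    chord-at? : ∀ x y → Dec (Chord m w x y)
    chord-at? x y =
      (suc x <? y) ×-dec (y ≤? m) ×-dec ((0 <? x) ⊎-dec (y <? m)) ×-dec adj? (w x) (w y)
  ... | yes (y , _ , x , _ , c) = yes (x , y , c)
  ... | no none = no λ (x , y , c) →
    none (y , s≤s (proj₁ (proj₂ c)) , x , <-trans (n<1+n x) (proj₁ c) , c)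

  record Shortening (m : ℕ) (w : ℕ → Fin n) : Set where
    field
      length      : ℕ
      vertex      : ℕ → Fin n
      shorter     : length < m
      closed      : ClosedWalk length vertex
      same-start  : vertex 0 ≡ w 0
      same-end    : vertex length ≡ w m
      interior-⊆  : ∀ {v} → Interior length vertex v → Interior m w v

  shortcut : ∀ {m' d w} → ClosedWalk (m' + d) w → ∀ {x} → 0 < d → x < m' → 2 ≤ m' →
             Adj G (w x) (w (suc x + d)) → Shortening (m' + d) w
  shortcut {m'} {d} {w} W {x} d>0 x<m' 2≤m' chord = record
    { length     = m'
    ; vertex     = w'
    ; shorter    = m<m+n m' d>0
    ; closed     = record
      { long           = 2≤m'
      ; walk           = walk'
      ; closing        = subst₂ (Adj G) (≡.sym same-end) (≡.sym same-start) (closing W)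
      ; ends-distinct  = λ e → ends-distinct W (trans (≡.sym same-start) (trans e same-end))
      ; start∉interior = λ I → start∉interior W (subst (Interior (m' + d) w) same-start (⊆ I))
      ; end∉interior   = λ I → end∉interior W (subst (Interior (m' + d) w) same-end (⊆ I))
      }
    ; same-start = same-start
    ; same-end   = same-end
    ; interior-⊆ = ⊆
    }
    where
    w' : ℕ → Fin n
    w' = splice x w (λ i → w (i + d))

    w'-≤ : ∀ {i} → i ≤ x → w' i ≡ w i
    w'-≤ = splice-≤ w (λ i → w (i + d))

    w'-> : ∀ {i} → x < i → w' i ≡ w (i + d)
    w'-> = splice-> w (λ i → w (i + d))

    same-start : w' 0 ≡ w 0
    same-start = w'-≤ z≤n

    same-end : w' m' ≡ w (m' + d)
    same-end = w'-> x<m'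

    x<m : x < m' + d
    x<m = <-≤-trans x<m' (m≤m+n m' d)

    walk' : IsWalk m' w'
    walk' i i<m' with <-cmp i x
    ... | tri< i<x _ _ = subst₂ (Adj G) (≡.sym (w'-≤ (<⇒≤ i<x))) (≡.sym (w'-≤ i<x))
                           (walk W i (<-trans i<x x<m))
    ... | tri≈ _ refl _ = subst₂ (Adj G) (≡.sym (w'-≤ ≤-refl)) (≡.sym (w'-> ≤-refl)) chord
    ... | tri> _ _ x<i = subst₂ (Adj G) (≡.sym (w'-> x<i)) (≡.sym (w'-> (m<n⇒m<1+n x<i)))
                           (walk W (i + d) (+-monoˡ-< d i<m'))

    ⊆ : ∀ {v} → Interior m' w' v → Interior (m' + d) w v
    ⊆ (i , 0<i , i<m' , eq) with ≤-<-connex i x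
    ... | inj₁ i≤x = i , 0<i , ≤-<-trans i≤x x<m , trans (≡.sym (w'-≤ i≤x)) eq
    ... | inj₂ x<i = i + d , <-≤-trans 0<i (m≤m+n i d) , +-monoˡ-< d i<m'
                   , trans (≡.sym (w'-> x<i)) eq

  shorten : ∀ {m w x y} → ClosedWalk m w → Chord m w x y → Shortening m w
  shorten {m} {w} {x} {y} W (sx<y , y≤m , inner , chord) =
    subst (λ k → Shortening k w) m'+d≡m
      (shortcut (subst (λ k → ClosedWalk k w) (≡.sym m'+d≡m) W) d>0 (s≤s (m≤m+n x r)) 2≤m'
        (subst (λ z → Adj G (w x) (w z)) (≡.sym sx+d≡y) chord))
    where
    d r : ℕ
    d = y ∸ suc x
    r = m ∸ y

    d>0 : 0 < d
    d>0 = m<n⇒0<n∸m sx<y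

    sx+d≡y : suc x + d ≡ y
    sx+d≡y = m+[n∸m]≡n (<⇒≤ sx<y)

    m'+d≡m : suc x + r + d ≡ m
    m'+d≡m = begin
      suc x + r + d  ≡⟨ xy∙z≈xz∙y (suc x) r d ⟩
      suc x + d + r  ≡⟨ cong (_+ r) sx+d≡y ⟩
      y + r          ≡⟨ m+[n∸m]≡n y≤m ⟩
      m              ∎
      where open ≡.≡-Reasoning

    2≤m' : 2 ≤ suc x + r
    2≤m' = s≤s (positive inner)
      where
      positive : 0 < x ⊎ y < m → 0 < x + r
      positive (inj₁ 0<x) = ≤-trans 0<x (m≤m+n x r)
      positive (inj₂ y<m) = ≤-trans (m<n⇒0<n∸m y<m) (m≤n+m r x)

  chordless-injective : ∀ {m w} → ClosedWalk m w → ¬ ∃₂ (Chord m w) →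
                        ∀ {x y} → x < y → y ≤ m → w x ≢ w y
  chordless-injective {w = w} W no-chord {x} {y} x<y y≤m eq with x | m≤n⇒m<n∨m≡n y≤m
  ... | zero   | inj₁ y<m  = start∉interior W (y , ≤-trans (s≤s z≤n) x<y , y<m , ≡.sym eq)
  ... | zero   | inj₂ refl = ends-distinct W eq
  ... | suc x' | inj₂ refl = end∉interior W (suc x' , s≤s z≤n , x<y , eq)
  ... | suc x' | inj₁ y<m  = no-chord (x' , y , x<y , y≤m , inj₂ y<m ,
                               subst (Adj G (w x')) eq (walk W x' (<-trans (n<1+n x') (<-trans x<y y<m))))

  closedWalk⇒cycle : ∀ {m w} → ClosedWalk m w → ¬ ∃₂ (Chord m w) → Cycle G m
  closedWalk⇒cycle {m} {w} W no-chord = record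
    { vtx      = λ i → w (toℕ i)
    ; distinct = vtx-injective
    ; edges    = λ i → subst (λ k → Adj G (w k) (w (suc (toℕ i)))) (≡.sym (toℕ-inject₁ i))
                             (walk W (toℕ i) (toℕ<n i))
    ; closing  = subst (λ k → Adj G (w k) (w 0)) (≡.sym (toℕ-fromℕ m)) (closing W)
    }
    where
    vtx-injective : ∀ {i j} → w (toℕ i) ≡ w (toℕ j) → i ≡ j
    vtx-injective {i} {j} eq with <-cmp (toℕ i) (toℕ j)
    ... | tri< i<j _ _ = ⊥-elim (chordless-injective W no-chord i<j (toℕ≤pred[n] j) eq)
    ... | tri≈ _ i≡j _ = toℕ-injective i≡j
    ... | tri> _ _ j<i = ⊥-elim (chordless-injective W no-chord j<i (toℕ≤pred[n] i) (≡.sym eq))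

  nonconsecutive⇒chord : ∀ {m w} {i j : Fin (suc m)} → toℕ i < toℕ j → ¬ Consecutive m i j →
                         Adj G (w (toℕ i)) (w (toℕ j)) → Chord m w (toℕ i) (toℕ j)
  nonconsecutive⇒chord {i = i} {j} i<j ¬cons a =
    ≤∧≢⇒< i<j (λ e → ¬cons (inj₁ (≡.sym e))) , toℕ≤pred[n] j , not-ends , a
    where
    not-ends : 0 < toℕ i ⊎ toℕ j < _
    not-ends with m≤n⇒m<n∨m≡n (toℕ≤pred[n] j)
    ... | inj₁ j<m = inj₂ j<m
    ... | inj₂ j≡m = inj₁ (n≢0⇒n>0 λ i≡0 → ¬cons (inj₂ (inj₂ (inj₂ (j≡m , i≡0)))))

  chordless-triangle : Chordal G → ∀ {m w} → ClosedWalk m w → ¬ ∃₂ (Chord m w) → m ≡ 2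
  chordless-triangle chordal {m} {w} W no-chord with m ≤? 2
  ... | yes m≤2 = ≤-antisym m≤2 (long W)
  ... | no m≰2 with chordal m (≰⇒> m≰2) (closedWalk⇒cycle W no-chord)
  ...   | i , j , i≢j , ¬cons , a with <-cmp (toℕ i) (toℕ j)
  ...     | tri< i<j _ _ = ⊥-elim (no-chord (_ , _ , nonconsecutive⇒chord {w = w} i<j ¬cons a))
  ...     | tri≈ _ i≡j _ = ⊥-elim (i≢j (toℕ-injective i≡j))
  ...     | tri> _ _ j<i = ⊥-elim (no-chord (_ , _ ,
                             nonconsecutive⇒chord {w = w} j<i (¬cons ∘ consecutive-sym) (Adj-sym a)))

  CommonNeighbour : ℕ → (ℕ → Fin n) → Set
  CommonNeighbour m w = ∃ λ v → Interior m w v × Adj G (w 0) v × Adj G v (w m)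

  Shortening-common-neighbour : ∀ {m w} (S : Shortening m w) →
    CommonNeighbour (Shortening.length S) (Shortening.vertex S) → CommonNeighbour m w
  Shortening-common-neighbour S (v , I , a , b) =
    v , interior-⊆ I , subst (λ z → Adj G z v) same-start a , subst (Adj G v) same-end b
    where open Shortening S

  common-neighbour : Chordal G → ∀ {m w} → ClosedWalk m w → CommonNeighbour m w
  common-neighbour chordal {m} = <-rec (λ m → ∀ w → ClosedWalk m w → CommonNeighbour m w) go m _
    where
    go : ∀ m → (∀ {k} → k < m → ∀ w → ClosedWalk k w → CommonNeighbour k w) →
         ∀ w → ClosedWalk m w → CommonNeighbour m w
    go m rec w W with chord? m w
    ... | yes (_ , _ , c) = Shortening-common-neighbour S (rec shorter vertex closed)
      where
      S = shorten W c
      open Shortening S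
    ... | no no-chord with chordless-triangle chordal W no-chord
    ...   | refl = w 1 , (1 , s≤s z≤n , s≤s (s≤s z≤n) , refl)
                 , walk W 0 (s≤s z≤n) , walk W 1 (s≤s (s≤s z≤n))

  record Path (S : Subset n) (u v : Fin n) : Set where
    field
      length  : ℕ
      vertex  : ℕ → Fin n
      start   : vertex 0 ≡ u
      end     : vertex length ≡ v
      inside  : ∀ {i} → i ≤ length → vertex i ∈ S
      walk    : IsWalk length vertex

  open Path

  Path-snoc : ∀ {S u v w} → Path S u v → Adj G v w → w ∈ S → Path S u w
  Path-snoc {S} {w = w} P e wS = record
    { length = suc (length P)
    ; vertex = p'
    ; start  = trans (p'-≤ z≤n) (start P)
    ; end    = p'-> ≤-refl
    ; inside = inside'
    ; walk   = walk'
    }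
    where
    p' : ℕ → Fin n
    p' = splice (length P) (vertex P) (λ _ → w)

    p'-≤ : ∀ {i} → i ≤ length P → p' i ≡ vertex P i
    p'-≤ = splice-≤ (vertex P) (λ _ → w)

    p'-> : ∀ {i} → length P < i → p' i ≡ w
    p'-> = splice-> (vertex P) (λ _ → w)

    inside' : ∀ {i} → i ≤ suc (length P) → p' i ∈ S
    inside' i≤ with m≤n⇒m<n∨m≡n i≤
    ... | inj₁ i<  = subst (_∈ S) (≡.sym (p'-≤ (≤-pred i<))) (inside P (≤-pred i<))
    ... | inj₂ refl = subst (_∈ S) (≡.sym (p'-> ≤-refl)) wS

    walk' : IsWalk (suc (length P)) p'
    walk' i i< with m≤n⇒m<n∨m≡n (≤-pred i<)
    ... | inj₁ i<k  = subst₂ (Adj G) (≡.sym (p'-≤ (<⇒≤ i<k))) (≡.sym (p'-≤ i<k)) (walk P i i<k)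
    ... | inj₂ refl = subst₂ (Adj G) (≡.sym (trans (p'-≤ ≤-refl) (end P))) (≡.sym (p'-> ≤-refl)) e

  reach⇒path : ∀ {S u v} → Reach G S u v → Path S u v
  reach⇒path {u = u} (here uS) = record
    { length = 0 ; vertex = λ _ → u ; start = refl ; end = refl ; inside = λ _ → uS ; walk = λ _ () }
  reach⇒path (step r e wS) = Path-snoc (reach⇒path r) e wS

  Path-prefix : ∀ {S u v} (P : Path S u v) {i} → i ≤ length P → Path S u (vertex P i)
  Path-prefix P {i} i≤ = record
    { length = i
    ; vertex = vertex P
    ; start  = start P
    ; end    = refl
    ; inside = λ j≤i → inside P (≤-trans j≤i i≤)
    ; walk   = λ j j<i → walk P j (<-≤-trans j<i i≤)
    }

  -- the walk b, p 0, …, p k, c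
  through : Fin n → (ℕ → Fin n) → ℕ → Fin n → ℕ → Fin n
  through b p k c zero    = b
  through b p k c (suc i) = splice k p (λ _ → c) i

  through-path : ∀ b p k c {i} → i ≤ k → through b p k c (suc i) ≡ p i
  through-path b p k c = splice-≤ {x = k} p (λ _ → c)

  through-end : ∀ b p k c → through b p k c (suc (suc k)) ≡ c
  through-end b p k c = splice-> {x = k} p (λ _ → c) ≤-refl

  interior-through : ∀ b p k c {x} → Interior (suc (suc k)) (through b p k c) x →
                     ∃ λ j → j ≤ k × p j ≡ x
  interior-through b p k c (suc j , _ , s≤s j<sk , eq) =
    j , ≤-pred j<sk , trans (≡.sym (through-path b p k c (≤-pred j<sk))) eq

  through-closedWalk : ∀ {S u v b c} (P : Path S u v) → b ∉ S → c ∉ S → b ≢ c →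
                       Adj G b c → Adj G b u → Adj G v c →
                       ClosedWalk (suc (suc (length P))) (through b (vertex P) (length P) c)
  through-closedWalk {S} {b = b} {c} P b∉S c∉S b≢c bc bu vc = record
    { long           = s≤s (s≤s z≤n)
    ; walk           = walk'
    ; closing        = subst (λ z → Adj G z b) (≡.sym w-end) (Adj-sym bc)
    ; ends-distinct  = λ e → b≢c (trans e w-end)
    ; start∉interior = b∉S ∘ interior-∈
    ; end∉interior   = λ I → c∉S (subst (_∈ S) w-end (interior-∈ I))
    }
    where
    k = length P
    w = through b (vertex P) k c
    w-path = through-path b (vertex P) k c
    w-end  = through-end b (vertex P) k c

    interior-∈ : ∀ {x} → Interior (suc (suc k)) w x → x ∈ S
    interior-∈ I with interior-through b (vertex P) k c I
    ... | j , j≤k , refl = inside P j≤k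

    walk' : IsWalk (suc (suc k)) w
    walk' zero _ = subst (Adj G b) (≡.sym (trans (w-path z≤n) (start P))) bu
    walk' (suc i) (s≤s i<sk) with m≤n⇒m<n∨m≡n (≤-pred i<sk)
    ... | inj₁ i<k  = subst₂ (Adj G) (≡.sym (w-path (<⇒≤ i<k))) (≡.sym (w-path i<k)) (walk P i i<k)
    ... | inj₂ refl = subst₂ (Adj G) (≡.sym (trans (w-path ≤-refl) (end P))) (≡.sym w-end) vc

  path-common-neighbour : Chordal G → ∀ {S u v b c} (P : Path S u v) → b ∉ S → c ∉ S → b ≢ c →
                          Adj G b c → Adj G b u → Adj G v c →
                          ∃ λ j → j ≤ length P × Adj G b (vertex P j) × Adj G (vertex P j) c
  path-common-neighbour chordal {b = b} {c} P b∉S c∉S b≢c bc bu vc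
    with common-neighbour chordal (through-closedWalk P b∉S c∉S b≢c bc bu vc)
  ... | x , I , bx , xc with interior-through b (vertex P) (length P) c I
  ...   | j , j≤k , refl =
    j , j≤k , bx , subst (Adj G (vertex P j)) (through-end b (vertex P) (length P) c) xc

module _ {n : ℕ} {G : Graph n} {C A : Subset n}
         (chordal : Chordal G) (clique : IsClique G C) (component : IsComponentOfRemoval G C A) where

  open Path

  private
    nonempty : ∃ λ v → v ∈ A
    nonempty = proj₁ component

    disjoint : ∀ {v} → v ∈ A → v ∉ C
    disjoint {v} = proj₁ (proj₂ component) v

    connected : ∀ u v → u ∈ A → v ∈ A → Reach G A u v
    connected = proj₁ (proj₂ (proj₂ component))

  first-neighbour-dominates : ∀ {B : Pred (Fin n) 0ℓ} → (∀ {b} → B b → b ∈ C) →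
    ∀ {u a c} (P : Path G A u a) → (∀ {b} → B b → Adj G u b) → Adj G a c → c ∈ C →
    ∃ λ y → y ∈ A × Adj G y c × (∀ {b} → B b → Adj G y b)
  first-neighbour-dominates {B} B⊆C {u} {a} {c} P u-B ac cC
    with least (λ i → adj? G (vertex P i) c) (subst (λ z → Adj G z c) (≡.sym (end P)) ac)
  ... | i , i≤k , ic , first = vertex P i , inside P i≤k , ic , sees
    where
    sees : ∀ {b} → B b → Adj G (vertex P i) b
    sees {b} Bb with b Fin.≟ c
    ... | yes refl = ic
    ... | no b≢c with path-common-neighbour G chordal (Path-prefix G P i≤k)
                        (λ bA → disjoint bA (B⊆C Bb)) (λ cA → disjoint cA cC) b≢c
                        (clique b c (B⊆C Bb) cC b≢c)
                        (Adj-sym G (u-B Bb)) ic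
    ...   | j , j≤i , bj , jc with m≤n⇒m<n∨m≡n j≤i
    ...     | inj₁ j<i  = ⊥-elim (first j<i jc)
    ...     | inj₂ refl = Adj-sym G bj

  dominating-vertex : (∀ {c} → c ∈ C → ∃ λ a → a ∈ A × Adj G c a) →
    ∀ (cs : List (Fin n)) → ∃ λ u → u ∈ A × (∀ {c} → c ∈ C → c List.∈ cs → Adj G u c)
  dominating-vertex _ [] with nonempty
  ... | u , uA = u , uA , λ _ ()
  dominating-vertex neighbour (c ∷ cs) with dominating-vertex neighbour cs | c ∈? C
  ... | u , uA , u-cs | no c∉C =
    u , uA , λ { bC (here refl) → ⊥-elim (c∉C bC) ; bC (there b∈) → u-cs bC b∈ }
  ... | u , uA , u-cs | yes cC with neighbour cC
  ...   | a , aA , ca with first-neighbour-dominates proj₁ (reach⇒path G (connected u a uA aA))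
                             (λ (bC , b∈) → u-cs bC b∈) (Adj-sym G ca) cC
  ...     | y , yA , yc , y-cs = y , yA , λ { _ (here refl) → yc ; bC (there b∈) → y-cs (bC , b∈) }

lemma15 : ∀ {n : ℕ} (G : Graph n) (C A : Subset n)
    → Chordal G
    → IsClique G C
    → (∃ λ v → v ∉ C)
    → IsComponentOfRemoval G C A
    → (∀ B → IsComponentOfRemoval G C B → ∣ B ∣ ≤ ∣ A ∣)
    → (Σ (Fin n) λ v → v ∈ C × (∀ a → a ∈ A → ¬ Adj G v a))
      ⊎ (Σ (Fin n) λ u → u ∈ A × (∀ c → c ∈ C → Adj G u c))
lemma15 {n} G C A chordal clique _ component _
  with any? (λ c → (c ∈? C) ×-dec ¬? (any? (λ a → (a ∈? A) ×-dec adj? G c a)))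
... | yes (c , cC , isolated) = inj₁ (c , cC , λ a aA ca → isolated (a , aA , ca))
... | no no-isolated with dominating-vertex chordal clique component neighbour (allFin n)
  where
  neighbour : ∀ {c} → c ∈ C → ∃ λ a → a ∈ A × Adj G c a
  neighbour {c} cC with any? (λ a → (a ∈? A) ×-dec adj? G c a)
  ... | yes found = found
  ... | no none   = ⊥-elim (no-isolated (c , cC , none))
...   | u , uA , dominates = inj₂ (u , uA , λ c cC → dominates cC (∈-allFin c))
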